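{- Let $B_{2,3}$ be the multigraph with two vertices joined by three parallel edges, and let $K_3\circ B_{2,3}$ be the graph obtained from a triangle $K_3$ by attaching to each of its three vertices its own copy of $B_{2,3}$, glued at one vertex of the copy. Then $\mathrm{sn}(K_3\circ B_{2,3})=2$ and $\mathrm{scw}(K_3\circ B_{2,3})=3$.
   Context: All graphs are finite connected multigraphs (multiple edges allowed, no loops). Scramble number: a scramble $\mathcal{S}$ on $G$ is a collection of subsets $E_i\subseteq V(G)$ (eggs) with each $G[E_i]$ connected. $h(\mathcal{S})$ is the minimum size of a set of vertices meeting every egg; an egg-cut is a set $T\subseteq E(G)$ such that $G-T$ has at least two distinct components each containing an egg, and $e(\mathcal{S})$ is the minimum size of an egg-cut. The order is $\|\mathcal{S}\|=\min\{h(\mathcal{S}),e(\mathcal{S})\}$; $\mathrm{sn}(G)$ is the maximum order of a scramble on $G$. Screewidth: a tree-cut decomposition of $G$ is a pair $(T,\mathcal{X})$ with $T$ a tree (vertices = nodes, edges = links) and $\mathcal{X}=\{X_b: b\in V(T)\}$ pairwise disjoint, possibly empty subsets of $V(G)$ (bags) with union $V(G)$. For a link $l$, $\mathrm{adh}(l)$ is the set of edges of $G$ with endpoints in bags $X_b,X_d$ where $b,d$ lie in different components of $T-l$; for a node $b$, $\mathrm{adh}(b)$ is the set of edges of $G$ with endpoints in bags $X_c,X_d$ where $c,d$ lie in different components of $T-b$. The width is $\max\{\max_l|\mathrm{adh}(l)|,\ \max_b(|X_b|+|\mathrm{adh}(b)|)\}$, and $\mathrm{scw}(G)$ is the minimum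 width over all tree-cut decompositions of $G$. -}

module Defs where

open import Data.Nat using (ℕ; _≤_; _+_)
open import Data.Fin using (Fin; zero; suc)
open import Data.Fin.Subset using (Subset; _∈_; _∉_; ∣_∣)
open import Data.Product using (Σ; ∃; ∃-syntax; _×_; _,_)
open import Data.Sum using (_⊎_)
open import Data.List using (List)
open import Data.List.Relation.Unary.All using (All)
open import Data.List.Relation.Unary.Any using (Any)
open import Data.Vec using (Vec; []; _∷_; lookup)
open import Relation.Binary.PropositionalEquality using (_≡_; _≢_)
open import Relation.Nullary using (¬_)

-- Finite multigraphs: vertices Fin nV, edges Fin nE, each edge has a
-- (unordered) pair of endpoints given by `ends`.

record Multigraph : Set where
  field
    nV   : ℕ
    nE   : ℕ
    ends : Fin nE → Fin nV × Fin nV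
open Multigraph public

Joins : (G : Multigraph) → Fin (nE G) → Fin (nV G) → Fin (nV G) → Set
Joins G e u v = (ends G e ≡ (u , v)) ⊎ (ends G e ≡ (v , u))

-- Walks from u to w using only allowed edges (EA) and whose vertices
-- after the first all satisfy VA.
data Reach (G : Multigraph) (EA : Fin (nE G) → Set) (VA : Fin (nV G) → Set)
     : Fin (nV G) → Fin (nV G) → Set where
  here : ∀ {u} → Reach G EA VA u u
  step : ∀ {u v w} (e : Fin (nE G)) → EA e → Joins G e u v → VA v →
         Reach G EA VA v w → Reach G EA VA u w

AllEdges : (G : Multigraph) → Fin (nE G) → Set
AllEdges G e = e ≡ e

AllVerts : (G : Multigraph) → Fin (nV G) → Set
AllVerts G v = v ≡ v

InducedConnected : (G : Multigraph) → Subset (nV G) → Set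
InducedConnected G X =
  (∃[ v ] v ∈ X) ×
  (∀ u v → u ∈ X → v ∈ X → Reach G (AllEdges G) (λ w → w ∈ X) u v)

Connected : Multigraph → Set
Connected G = (Fin (nV G)) × (∀ u v → Reach G (AllEdges G) (AllVerts G) u v)

CardIs : {k : ℕ} → (Fin k → Set) → ℕ → Set
CardIs {k} P s = Σ (Subset k) λ A → (∀ x → (x ∈ A → P x) × (P x → x ∈ A)) × (∣ A ∣ ≡ s)

_∈S_ : {A : Set} → A → List A → Set
x ∈S xs = Any (λ y → x ≡ y) xs

record Scramble (G : Multigraph) : Set where
  field
    eggs      : List (Subset (nV G))
    eggsConn  : All (InducedConnected G) eggs
open Scramble public

HittingSet : {G : Multigraph} → Scramble G → Subset (nV G) → Set
HittingSet S C = All (λ X → ∃[ v ] (v ∈ C × v ∈ X)) (eggs S)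

-- T ⊆ E(G) is an egg-cut: G - T has two distinct components each
-- containing an egg.
EggCut : {G : Multigraph} → Scramble G → Subset (nE G) → Set
EggCut {G} S T =
  ∃[ X₁ ] ∃[ X₂ ] ∃[ u ] ∃[ v ]
    (X₁ ∈S eggs S) × (X₂ ∈S eggs S) × u ∈ X₁ × v ∈ X₂ ×
    (∀ x → x ∈ X₁ → R u x) × (∀ y → y ∈ X₂ → R v y) × ¬ R u v
  where
  R : Fin (nV G) → Fin (nV G) → Set
  R = Reach G (λ e → e ∉ T) (AllVerts G)

-- ‖S‖ = k, where ‖S‖ = min{h(S), e(S)} (e(S) = ∞ if no egg-cut exists)
OrderIs : {G : Multigraph} → Scramble G → ℕ → Set
OrderIs S k =
  (∀ C → HittingSet S C → k ≤ ∣ C ∣) ×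
  (∀ T → EggCut S T → k ≤ ∣ T ∣) ×
  ((∃[ C ] (HittingSet S C × ∣ C ∣ ≡ k)) ⊎ (∃[ T ] (EggCut S T × ∣ T ∣ ≡ k)))

ScrambleNumberIs : Multigraph → ℕ → Set
ScrambleNumberIs G k =
  (∃[ S ] OrderIs {G} S k) × (∀ (S : Scramble G) j → OrderIs S j → j ≤ k)

IsTree : Multigraph → Set
IsTree T =
  Connected T ×
  (∀ l u v → Joins T l u v → ¬ Reach T (λ l' → l' ≢ l) (AllVerts T) u v)

-- A tree-cut decomposition: a tree T and bags given by assigning each
-- vertex of G to the node whose bag contains it (so bags are pairwise
-- disjoint, possibly empty, and cover V(G)).
record TreeCutDecomposition (G : Multigraph) : Set where
  field
    tree   : Multigraph
    isTree : IsTree tree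
    bag    : Fin (nV G) → Fin (nV tree)
open TreeCutDecomposition public

InBag : {G : Multigraph} (D : TreeCutDecomposition G) → Fin (nV (tree D)) → Fin (nV G) → Set
InBag D b v = bag D v ≡ b

AdhLink : {G : Multigraph} (D : TreeCutDecomposition G) → Fin (nE (tree D)) → Fin (nE G) → Set
AdhLink {G} D l e =
  ∃[ u ] ∃[ v ] Joins G e u v ×
    ¬ Reach (tree D) (λ l' → l' ≢ l) (AllVerts (tree D)) (bag D u) (bag D v)

AdhNode : {G : Multigraph} (D : TreeCutDecomposition G) → Fin (nV (tree D)) → Fin (nE G) → Set
AdhNode {G} D b e =
  ∃[ u ] ∃[ v ] Joins G e u v × bag D u ≢ b × bag D v ≢ b ×
    ¬ Reach (tree D) (AllEdges (tree D)) (λ c → c ≢ b) (bag D u) (bag D v)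

WidthIs : {G : Multigraph} → TreeCutDecomposition G → ℕ → Set
WidthIs D w =
  (∀ l s → CardIs (AdhLink D l) s → s ≤ w) ×
  (∀ b s t → CardIs (InBag D b) s → CardIs (AdhNode D b) t → s + t ≤ w) ×
  ((∃[ l ] CardIs (AdhLink D l) w) ⊎
   (∃[ b ] ∃[ s ] ∃[ t ] (CardIs (InBag D b) s × CardIs (AdhNode D b) t × s + t ≡ w)))

ScreewidthIs : Multigraph → ℕ → Set
ScreewidthIs G k =
  (∃[ D ] WidthIs {G} D k) × (∀ (D : TreeCutDecomposition G) w → WidthIs D w → k ≤ w)

K3∘B23-ends : Vec (Fin 6 × Fin 6) 12
K3∘B23-ends =
  (v0 , v1) ∷ (v1 , v2) ∷ (v0 , v2) ∷
  (v0 , v3) ∷ (v0 , v3) ∷ (v0 , v3) ∷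
  (v1 , v4) ∷ (v1 , v4) ∷ (v1 , v4) ∷
  (v2 , v5) ∷ (v2 , v5) ∷ (v2 , v5) ∷ []
  where
  v0 v1 v2 v3 v4 v5 : Fin 6
  v0 = zero
  v1 = suc zero
  v2 = suc (suc zero)
  v3 = suc (suc (suc zero))
  v4 = suc (suc (suc (suc zero)))
  v5 = suc (suc (suc (suc (suc zero))))

K3∘B23 : Multigraph
K3∘B23 = record { nV = 6 ; nE = 12 ; ends = lookup K3∘B23-ends }

-- The leaf eggs {3} and {4} are disjoint and joined by two edge-disjoint walks, so they form a
-- scramble of order 2. Conversely every scramble has a hitting set or an egg-cut of size 2: if
-- {0,1} misses an egg, that egg lies in a single branch {i, i+3}; if this branch misses another
-- egg, the two edges leaving the branch separate the two eggs.
--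
-- Putting each branch into its own bag along a path with three nodes gives width 3 (the middle
-- bag plus the edge 02 in its adhesion). In a decomposition of width at most 2, three parallel
-- edges cannot cross a link, so each leaf shares the bag of its triangle vertex; these bags are
-- then distinct, and the median of the three bag nodes in the tree is either one of them, whose
-- adhesion contains the opposite triangle edge, or a fourth node whose adhesion contains all three
-- triangle edges. Either way some node has weight 3.
module Submission where

open import Defs
open import Data.Bool using (Bool; true; false; _xor_; _∨_)
open import Data.Bool.Properties using (xor-comm; xor-same; ∨-comm)
open import Data.Empty using (⊥; ⊥-elim)
open import Data.Fin using (Fin; zero; suc; _≟_)
open import Data.Fin.Properties using (any?)
open import Data.Fin.Subset using (Subset; _∈_; _∉_; _⊆_; ∣_∣; ⁅_⁆; _∪_; _-_; _─_) renaming (⊥ to ∅)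
open import Data.Fin.Subset.Properties
  using ( _∈?_; _⊆?_; ∉⊥; x∈⁅x⁆; x∈⁅y⁆⇒x≡y; x∈p∪q⁻; x∈p∩q⁺; x∈p∧x∉q⇒x∈p─q; p─q⊆p
        ; p⊆q⇒∣p∣≤∣q∣; p⊂q⇒∣p∣<∣q∣; x∈p⇒p-x⊂p; x∈p∧x≢y⇒x∈p-y; ∣⁅x⁆∣≡1 )
open import Data.List using (List; []; _∷_)
open import Data.List.Membership.Propositional using (find)
open import Data.List.Relation.Unary.All as All using (All; []; _∷_; all?)
open import Data.List.Relation.Unary.All.Properties using (¬All⇒Any¬)
open import Data.List.Relation.Unary.Any using (here; there)
open import Data.Nat using (ℕ; zero; suc; _≤_; _+_; z≤n; s≤s; _≤?_)
open import Data.Nat.Properties using (≤-refl; ≤-trans; +-mono-≤; ≤-pred; ≰⇒>)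
open import Data.Product using (Σ; ∃-syntax; _×_; _,_; proj₁; proj₂)
open import Data.Sum using (_⊎_; inj₁; inj₂; [_,_]′)
open import Data.Vec using (lookup; tabulate)
open import Data.Vec.Properties using (lookup∘tabulate; []=⇒lookup; lookup⇒[]=)
open import Function using (_∘_)
open import Relation.Binary.PropositionalEquality using (_≡_; _≢_; refl; sym; trans; cong; subst)
open import Relation.Nullary using (¬_; Dec; yes; no; does)
open import Relation.Nullary.Decidable using (_×-dec_; from-yes; ¬¬-excluded-middle)

lookup≡true⇒∈ : ∀ {n} {p : Subset n} {x} → lookup p x ≡ true → x ∈ p
lookup≡true⇒∈ = lookup⇒[]= _ _

lookup≡false⇒∉ : ∀ {n} {p : Subset n} {x} → lookup p x ≡ false → x ∉ p
lookup≡false⇒∉ eq x∈p with trans (sym eq) ([]=⇒lookup x∈p)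
... | ()

∉⇒lookup≡false : ∀ {n} {p : Subset n} {x} → x ∉ p → lookup p x ≡ false
∉⇒lookup≡false {p = p} {x} x∉p with lookup p x in eq
... | true  = ⊥-elim (x∉p (lookup≡true⇒∈ eq))
... | false = refl

∈-tabulate⁺ : ∀ {n} {f : Fin n → Bool} {x} → f x ≡ true → x ∈ tabulate f
∈-tabulate⁺ {f = f} {x} fx = lookup≡true⇒∈ (trans (lookup∘tabulate f x) fx)

∈-tabulate⁻ : ∀ {n} {f : Fin n → Bool} {x} → x ∈ tabulate f → f x ≡ true
∈-tabulate⁻ {f = f} {x} x∈ = trans (sym (lookup∘tabulate f x)) ([]=⇒lookup x∈)

fromList : ∀ {n} → List (Fin n) → Subset n
fromList []       = ∅
fromList (x ∷ xs) = ⁅ x ⁆ ∪ fromList xs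

fromList⊆ : ∀ {n} {P : Fin n → Set} {xs} → All P xs → ∀ {x} → x ∈ fromList xs → P x
fromList⊆ []                 x∈ = ⊥-elim (∉⊥ x∈)
fromList⊆ {P = P} (px ∷ pxs) x∈ with x∈p∪q⁻ ⁅ _ ⁆ _ x∈
... | inj₁ x∈⁅y⁆ = subst P (sym (x∈⁅y⁆⇒x≡y _ x∈⁅y⁆)) px
... | inj₂ x∈xs  = fromList⊆ pxs x∈xs

x∈p∧y∈p∧x≢y⇒2≤∣p∣ : ∀ {n} {p : Subset n} {x y} → x ∈ p → y ∈ p → x ≢ y → 2 ≤ ∣ p ∣
x∈p∧y∈p∧x≢y⇒2≤∣p∣ {p = p} {x} {y} x∈p y∈p x≢y =
  ≤-trans (s≤s 1≤∣p-y∣) (p⊂q⇒∣p∣<∣q∣ (x∈p⇒p-x⊂p y∈p))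
  where
  1≤∣p-y∣ : 1 ≤ ∣ p - y ∣
  1≤∣p-y∣ = subst (_≤ ∣ p - y ∣) (∣⁅x⁆∣≡1 x)
    (p⊆q⇒∣p∣≤∣q∣ λ z∈ → subst (_∈ p - y) (sym (x∈⁅y⁆⇒x≡y x z∈)) (x∈p∧x≢y⇒x∈p-y x∈p x≢y))

CardIs-⊆ : ∀ {k} {P : Fin k → Set} {s B} → CardIs P s → (∀ {x} → P x → x ∈ B) → s ≤ ∣ B ∣
CardIs-⊆ (A , A⇔P , refl) P⊆B = p⊆q⇒∣p∣≤∣q∣ λ {x} x∈A → P⊆B (proj₁ (A⇔P x) x∈A)

CardIs-⊇ : ∀ {k} {P : Fin k → Set} {s B} → CardIs P s → (∀ {x} → x ∈ B → P x) → ∣ B ∣ ≤ s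
CardIs-⊇ (A , A⇔P , refl) B⊆P = p⊆q⇒∣p∣≤∣q∣ λ {x} x∈B → proj₂ (A⇔P x) (B⊆P x∈B)

¬¬-decidable : ∀ {k} (P : Fin k → Set) → ¬ ¬ (∀ x → Dec (P x))
¬¬-decidable {zero}  P κ = κ λ ()
¬¬-decidable {suc k} P κ =
  ¬¬-excluded-middle λ P₀? → ¬¬-decidable (P ∘ suc) λ P? → κ λ { zero → P₀? ; (suc x) → P? x }

-- Width bounds only speak about predicates that have a cardinality; classically all of them do.
¬¬-CardIs : ∀ {k} (P : Fin k → Set) → ¬ ¬ (Σ ℕ (CardIs P))
¬¬-CardIs P κ = ¬¬-decidable P λ P? →
  κ (_ , tabulate (does ∘ P?) , (λ x → sound (P? x) ∘ ∈-tabulate⁻ , ∈-tabulate⁺ ∘ complete (P? x)) , refl)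
  where
  sound : ∀ {A : Set} (A? : Dec A) → does A? ≡ true → A
  sound (yes a) _ = a
  sound (no _)  ()
  complete : ∀ {A : Set} (A? : Dec A) → A → does A? ≡ true
  complete (yes _) _ = refl
  complete (no ¬a) a = ⊥-elim (¬a a)

Reach∖ˡ : (H : Multigraph) → Fin (nE H) → Fin (nV H) → Fin (nV H) → Set
Reach∖ˡ H l = Reach H (_≢ l) (AllVerts H)

Reach∖ᵛ : (H : Multigraph) → Fin (nV H) → Fin (nV H) → Fin (nV H) → Set
Reach∖ᵛ H m = Reach H (AllEdges H) (_≢ m)

module _ {H : Multigraph} where

  Joins-sym : ∀ {e u v} → Joins H e u v → Joins H e v u
  Joins-sym (inj₁ p) = inj₂ p
  Joins-sym (inj₂ p) = inj₁ p

  Joins-endpoint : ∀ {e p q u v} → Joins H e p q → Joins H e u v → p ≡ u ⊎ p ≡ v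
  Joins-endpoint (inj₁ p) (inj₁ q) = inj₁ (cong proj₁ (trans (sym p) q))
  Joins-endpoint (inj₁ p) (inj₂ q) = inj₂ (cong proj₁ (trans (sym p) q))
  Joins-endpoint (inj₂ p) (inj₁ q) = inj₂ (cong proj₂ (trans (sym p) q))
  Joins-endpoint (inj₂ p) (inj₂ q) = inj₁ (cong proj₂ (trans (sym p) q))

  module _ {EA : Fin (nE H) → Set} {VA : Fin (nV H) → Set} where

    _++ʳ_ : ∀ {u v w} → Reach H EA VA u v → Reach H EA VA v w → Reach H EA VA u w
    here             ++ʳ q = q
    step e ea j va p ++ʳ q = step e ea j va (p ++ʳ q)

    Reach-reverse : ∀ {u w} → VA u → Reach H EA VA u w → Reach H EA VA w u
    Reach-reverse vu here               = here
    Reach-reverse vu (step e ea j vv p) = Reach-reverse vv p ++ʳ step e ea (Joins-sym j) vu here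

    Reach-split : ∀ x {u w} → Reach H EA VA u w →
                  Reach H EA (λ c → VA c × c ≢ x) u w ⊎ Reach H EA VA x w
    Reach-split x here = inj₁ here
    Reach-split x (step {v = v} e ea j va p) with Reach-split x p
    ... | inj₂ q = inj₂ q
    ... | inj₁ q with v ≟ x
    ...   | yes refl = inj₂ p
    ...   | no v≢x   = inj₁ (step e ea j (va , v≢x) q)

  Reach-map : ∀ {EA EA' : Fin (nE H) → Set} {VA VA' : Fin (nV H) → Set} →
              (∀ {e} → EA e → EA' e) → (∀ {v} → VA v → VA' v) →
              ∀ {u w} → Reach H EA VA u w → Reach H EA' VA' u w
  Reach-map f g here               = here
  Reach-map f g (step e ea j va p) = step e (f ea) j (g va) (Reach-map f g p)

  Reach-restrict : ∀ {EA EA' : Fin (nE H) → Set} {Q VA' : Fin (nV H) → Set} →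
                   (∀ {e x y} → Joins H e x y → Q x → Q y → EA' e) → (∀ {v} → Q v → VA' v) →
                   ∀ {u w} → Q u → Reach H EA Q u w → Reach H EA' VA' u w
  Reach-restrict f g qu here              = here
  Reach-restrict f g qu (step e _ j qv p) = step e (f j qu qv) j (g qv) (Reach-restrict f g qv p)

  Reach∖ᵛ⇒Reach∖ˡ : ∀ {l p q a y} → Joins H l p q → a ≢ p → Reach∖ᵛ H p a y → Reach∖ˡ H l a y
  Reach∖ᵛ⇒Reach∖ˡ jl a≢p here = here
  Reach∖ᵛ⇒Reach∖ˡ {l} {p} jl a≢p (step e _ j c≢p r) = step e e≢l j refl (Reach∖ᵛ⇒Reach∖ˡ jl c≢p r)
    where
    e≢l : e ≢ l
    e≢l refl with Joins-endpoint jl j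
    ... | inj₁ p≡a = a≢p (sym p≡a)
    ... | inj₂ p≡c = c≢p (sym p≡c)

  LastExit : Fin (nV H) → Fin (nV H) → Set
  LastExit x y = ∃[ l ] ∃[ z ] Joins H l x z × z ≢ x × Reach∖ᵛ H x z y

  last-exit : ∀ {x y} → x ≢ y → Reach H (AllEdges H) (AllVerts H) x y → LastExit x y
  last-exit {x} {y} x≢y r = [ first-step , (λ exit → exit) ]′ (avoid-or-exit r)
    where
    first-step : Reach∖ᵛ H x x y → LastExit x y
    first-step here                  = ⊥-elim (x≢y refl)
    first-step (step l _ j z≢x rest) = l , _ , j , z≢x , rest
    avoid-or-exit : ∀ {a} → Reach H (AllEdges H) (AllVerts H) a y → Reach∖ᵛ H x a y ⊎ LastExit x y
    avoid-or-exit here = inj₁ here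
    avoid-or-exit (step {v = c} e _ j _ rest) with avoid-or-exit rest
    ... | inj₂ exit = inj₂ exit
    ... | inj₁ r with c ≟ x
    ...   | yes refl = inj₂ (first-step r)
    ...   | no c≢x   = inj₁ (step e refl j c≢x r)

edgesBy : (H : Multigraph) → (Bool → Bool → Bool) → Subset (nV H) → Subset (nE H)
edgesBy H f A = tabulate λ e → f (lookup A (proj₁ (ends H e))) (lookup A (proj₂ (ends H e)))

δ : (H : Multigraph) → Subset (nV H) → Subset (nE H)
δ H = edgesBy H _xor_

incident : (H : Multigraph) → Subset (nV H) → Subset (nE H)
incident H = edgesBy H _∨_

xor≡false⇒≡ : ∀ a b → a xor b ≡ false → a ≡ b
xor≡false⇒≡ true  true  _ = refl
xor≡false⇒≡ false false _ = refl
xor≡false⇒≡ true  false ()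
xor≡false⇒≡ false true  ()

∨≡false : ∀ {a b} → a ≡ false → b ≡ false → a ∨ b ≡ false
∨≡false refl refl = refl

module _ {H : Multigraph} where

  lookup-edgesBy : ∀ {f} → (∀ a b → f a b ≡ f b a) → ∀ A {e x y} → Joins H e x y →
                   lookup (edgesBy H f A) e ≡ f (lookup A x) (lookup A y)
  lookup-edgesBy {f} comm A {e} j = trans (lookup∘tabulate _ e) (orient j)
    where
    atEnds : Fin (nV H) × Fin (nV H) → Bool
    atEnds (a , b) = f (lookup A a) (lookup A b)
    orient : ∀ {x y} → Joins H e x y → atEnds (ends H e) ≡ f (lookup A x) (lookup A y)
    orient (inj₁ p) = cong atEnds p
    orient (inj₂ p) = trans (cong atEnds p) (comm _ _)

  ∉δ⇒same-side : ∀ A {e x y} → Joins H e x y → e ∉ δ H A → lookup A x ≡ lookup A y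
  ∉δ⇒same-side A j e∉ = xor≡false⇒≡ _ _ (trans (sym (lookup-edgesBy xor-comm A j)) (∉⇒lookup≡false e∉))

  same-side⇒∉δ : ∀ A {e x y} → Joins H e x y → lookup A x ≡ lookup A y → e ∉ δ H A
  same-side⇒∉δ A {x = x} j same = lookup≡false⇒∉
    (trans (lookup-edgesBy xor-comm A j) (trans (cong (lookup A x xor_) (sym same)) (xor-same (lookup A x))))

  ∉-both⇒∉incident : ∀ C {e x y} → Joins H e x y → x ∉ C → y ∉ C → e ∉ incident H C
  ∉-both⇒∉incident C j x∉ y∉ = lookup≡false⇒∉
    (trans (lookup-edgesBy ∨-comm C j) (∨≡false (∉⇒lookup≡false x∉) (∉⇒lookup≡false y∉)))

  Reach-δ : ∀ {EA VA} A → (∀ {e} → EA e → e ∉ δ H A) →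
            ∀ {u w} → Reach H EA VA u w → lookup A u ≡ lookup A w
  Reach-δ A avoid here              = refl
  Reach-δ A avoid (step e ea j _ p) = trans (∉δ⇒same-side A j (avoid ea)) (Reach-δ A avoid p)

  sole-crossing-link-is-bridge : ∀ A {l u v} → (∀ {e} → e ∈ δ H A → e ≡ l) → l ∈ δ H A →
                                 Joins H l u v → ¬ Reach∖ˡ H l u v
  sole-crossing-link-is-bridge A sole l∈δ j u⇝v =
    same-side⇒∉δ A j (Reach-δ A (λ e≢l e∈δ → e≢l (sole e∈δ)) u⇝v) l∈δ

  linked-via-hubs : ∀ {EA VA} (σ : Subset (nV H)) (hub : Bool → Fin (nV H)) →
                    (∀ {x} → VA x → Reach H EA VA x (hub (lookup σ x))) →
                    ∀ {x y} → VA x → VA y → lookup σ x ≡ lookup σ y → Reach H EA VA x y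
  linked-via-hubs {EA} {VA} σ hub to-hub {x} {y} vx vy same =
    to-hub vx ++ʳ Reach-reverse vy (subst (Reach H EA VA y ∘ hub) (sym same) (to-hub vy))

module _ {H : Multigraph} where

  singleton-connected : ∀ v → InducedConnected H ⁅ v ⁆
  singleton-connected v = (v , x∈⁅x⁆ v) , walk
    where
    walk : ∀ u w → u ∈ ⁅ v ⁆ → w ∈ ⁅ v ⁆ → Reach H (AllEdges H) (_∈ ⁅ v ⁆) u w
    walk u w u∈ w∈ with x∈⁅y⁆⇒x≡y v u∈ | x∈⁅y⁆⇒x≡y v w∈
    ... | refl | refl = here

  hitting-or-missed : (S : Scramble H) (C : Subset (nV H)) →
                      HittingSet S C ⊎ ∃[ X ] X ∈S eggs S × (∀ {v} → v ∈ X → v ∉ C)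
  hitting-or-missed S C = decide (all? meets? (eggs S))
    where
    meets? : ∀ X → Dec (∃[ v ] v ∈ C × v ∈ X)
    meets? X = any? λ v → (v ∈? C) ×-dec (v ∈? X)
    decide : Dec (HittingSet S C) → HittingSet S C ⊎ ∃[ X ] X ∈S eggs S × (∀ {v} → v ∈ X → v ∉ C)
    decide (yes hits) = inj₁ hits
    decide (no ¬hits) with find (¬All⇒Any¬ meets? (eggs S) ¬hits)
    ... | X , X∈S , missed = inj₂ (X , X∈S , λ v∈X v∈C → missed (_ , v∈C , v∈X))

  Reach-within-side : ∀ A b {X} → (∀ {v} → v ∈ X → lookup A v ≡ b) → InducedConnected H X →
                      ∀ {u x} → u ∈ X → x ∈ X → Reach H (_∉ δ H A) (AllVerts H) u x
  Reach-within-side A b side (_ , walks) u∈X x∈X =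
    Reach-restrict (λ j x∈ y∈ → same-side⇒∉δ A j (trans (side x∈) (sym (side y∈)))) (λ _ → refl)
                   u∈X (walks _ _ u∈X x∈X)

  eggCut-δ : (S : Scramble H) (A : Subset (nV H)) {X Y : Subset (nV H)} →
             X ∈S eggs S → Y ∈S eggs S → (∀ {v} → v ∈ X → v ∈ A) → (∀ {v} → v ∈ Y → v ∉ A) →
             EggCut S (δ H A)
  eggCut-δ S A {X} {Y} X∈S Y∈S X⊆A Y∩A≡∅
    with All.lookup (eggsConn S) X∈S | All.lookup (eggsConn S) Y∈S
  ... | X-conn@((u , u∈X) , _) | Y-conn@((v , v∈Y) , _) =
    X , Y , u , v , X∈S , Y∈S , u∈X , v∈Y ,
    (λ x x∈X → Reach-within-side A true inside X-conn u∈X x∈X) ,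
    (λ y y∈Y → Reach-within-side A false outside Y-conn v∈Y y∈Y) ,
    λ r → separated (Reach-δ A (λ e∉ → e∉) r)
    where
    inside : ∀ {x} → x ∈ X → lookup A x ≡ true
    inside x∈X = []=⇒lookup (X⊆A x∈X)
    outside : ∀ {y} → y ∈ Y → lookup A y ≡ false
    outside y∈Y = ∉⇒lookup≡false (Y∩A≡∅ y∈Y)
    separated : lookup A u ≡ lookup A v → ⊥
    separated eq with trans (sym (inside u∈X)) (trans eq (outside v∈Y))
    ... | ()

  edge-disjoint-walks⇒2≤cut : ∀ {VA} {E₁ E₂ T : Subset (nE H)} {u v} → (∀ {e} → e ∈ E₁ → e ∉ E₂) →
                              Reach H (_∈ E₁) VA u v → Reach H (_∈ E₂) VA u v →
                              ¬ Reach H (_∉ T) VA u v → 2 ≤ ∣ T ∣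
  edge-disjoint-walks⇒2≤cut {VA} {E₁} {E₂} {T} {u} {v} disjoint p₁ p₂ cut = distinct (meets p₁) (meets p₂)
    where
    meets : ∀ {E} → Reach H (_∈ E) VA u v → ∃[ e ] e ∈ E × e ∈ T
    meets {E} p with any? (λ e → (e ∈? E) ×-dec (e ∈? T))
    ... | yes found = found
    ... | no  none  = ⊥-elim (cut (Reach-map (λ e∈E e∈T → none (_ , e∈E , e∈T)) (λ va → va) p))
    distinct : ∃[ e ] e ∈ E₁ × e ∈ T → ∃[ e ] e ∈ E₂ × e ∈ T → 2 ≤ ∣ T ∣
    distinct (a , a∈E₁ , a∈T) (b , b∈E₂ , b∈T) =
      x∈p∧y∈p∧x≢y⇒2≤∣p∣ a∈T b∈T λ { refl → disjoint a∈E₁ b∈E₂ }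

module _ {T : Multigraph} (T-tree : IsTree T) where

  private
    Node : Set
    Node = Fin (nV T)

    connected : ∀ x y → Reach T (AllEdges T) (AllVerts T) x y
    connected = proj₂ (proj₁ T-tree)

    bridge : ∀ {l x z} → Joins T l x z → ¬ Reach∖ˡ T l x z
    bridge = proj₂ T-tree _ _ _

  separating-link : ∀ {x y} → x ≢ y → ∃[ l ] ¬ Reach∖ˡ T l x y
  separating-link {x} {y} x≢y with last-exit x≢y (connected x y)
  ... | l , z , j , z≢x , z⇝y =
    l , λ x⇝y → bridge j (x⇝y ++ʳ Reach-reverse refl (Reach∖ᵛ⇒Reach∖ˡ j z≢x z⇝y))

  -- Follow a walk from b₀ to b₁, keeping a candidate x that is b₀ or separates b₀ from b₁ but does
  -- not separate b₁ from b₂. Stepping from x to a neighbour on the side of b₁ yields a new candidate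
  -- unless that neighbour is a median; a candidate can never be b₁, so the walk never arrives.
  private
    module Median {b₀ b₁ b₂ : Node} (b₀≢b₁ : b₀ ≢ b₁) (b₀≢b₂ : b₀ ≢ b₂)
      (r₀ : Reach∖ᵛ T b₀ b₁ b₂) (r₁ : Reach∖ᵛ T b₁ b₀ b₂) (r₂ : Reach∖ᵛ T b₂ b₀ b₁)
      (no-median : ∀ m → m ≢ b₀ → m ≢ b₁ → m ≢ b₂ →
                   ¬ Reach∖ᵛ T m b₀ b₁ → ¬ Reach∖ᵛ T m b₀ b₂ → ¬ Reach∖ᵛ T m b₁ b₂ → ⊥) where

      Candidate : Node → Set
      Candidate x = x ≢ b₁ × x ≢ b₂ × Reach∖ᵛ T x b₁ b₂ × (x ≡ b₀ ⊎ (x ≢ b₀ × ¬ Reach∖ᵛ T x b₀ b₁))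

      link-cuts-off-b₀ : ∀ {l x z} → Joins T l x z → Reach∖ᵛ T x z b₁ → Candidate x → ¬ Reach∖ˡ T l b₀ z
      link-cuts-off-b₀ j _ (_ , _ , _ , inj₁ refl) b₀⇝z = bridge j b₀⇝z
      link-cuts-off-b₀ {x = x} j z⇝b₁ (_ , _ , _ , inj₂ (_ , x-cuts)) b₀⇝z with Reach-split x b₀⇝z
      ... | inj₁ avoiding-x = x-cuts (Reach-map (λ _ → refl) proj₂ avoiding-x ++ʳ z⇝b₁)
      ... | inj₂ x⇝z        = bridge j x⇝z

      advance : ∀ {l x z} → Joins T l x z → z ≢ x → Reach∖ᵛ T x z b₁ → Candidate x → ¬ ¬ Candidate z
      advance {l} {x} {z} j z≢x z⇝b₁ cand@(x≢b₁ , _ , b₁⇝b₂ , _) ¬cand =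
        ¬¬-excluded-middle λ where
          (yes b₁⇝b₂∖z) → ¬cand (z≢b₁ , z≢b₂ , b₁⇝b₂∖z , inj₂ (z≢b₀ , z-cuts z⇝ˡb₁))
          (no  z-cuts₁₂) → no-median z z≢b₀ z≢b₁ z≢b₂ (z-cuts z⇝ˡb₁) (z-cuts z⇝ˡb₂) z-cuts₁₂
        where
        z⇝ˡb₁ : Reach∖ˡ T l z b₁
        z⇝ˡb₁ = Reach∖ᵛ⇒Reach∖ˡ j z≢x z⇝b₁
        z⇝ˡb₂ : Reach∖ˡ T l z b₂
        z⇝ˡb₂ = z⇝ˡb₁ ++ʳ Reach∖ᵛ⇒Reach∖ˡ j (λ b₁≡x → x≢b₁ (sym b₁≡x)) b₁⇝b₂
        cut : ¬ Reach∖ˡ T l b₀ z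
        cut = link-cuts-off-b₀ j z⇝b₁ cand
        z≢b₀ : z ≢ b₀
        z≢b₀ refl = cut here
        z-cuts : ∀ {y} → Reach∖ˡ T l z y → ¬ Reach∖ᵛ T z b₀ y
        z-cuts z⇝y b₀⇝y = cut (Reach∖ᵛ⇒Reach∖ˡ (Joins-sym {H = T} j) (λ b₀≡z → z≢b₀ (sym b₀≡z)) b₀⇝y
                               ++ʳ Reach-reverse refl z⇝y)
        z≢b₁ : z ≢ b₁
        z≢b₁ refl = z-cuts z⇝ˡb₂ r₁
        z≢b₂ : z ≢ b₂
        z≢b₂ refl = z-cuts z⇝ˡb₁ r₂

      Behind : Node → Node → Set
      Behind x a = a ≡ x ⊎ (a ≢ x × ¬ Reach∖ᵛ T x a b₁)

      follow : ∀ x a → Candidate x → Behind x a → Reach T (AllEdges T) (AllVerts T) a b₁ → ⊥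
      follow x a cand (inj₁ refl)      here = proj₁ cand refl
      follow x a cand (inj₂ (_ , cut)) here = cut here
      follow x a cand (inj₂ (_ , cut)) (step {v = c} e _ j _ rest) with c ≟ x
      ... | yes c≡x = follow x c cand (inj₁ c≡x) rest
      ... | no  c≢x = follow x c cand (inj₂ (c≢x , λ c⇝b₁ → cut (step e refl j c≢x c⇝b₁))) rest
      follow x a cand (inj₁ refl) (step {v = c} e _ j _ rest) with c ≟ x
      ... | yes c≡x = follow x c cand (inj₁ c≡x) rest
      ... | no  c≢x = ¬¬-excluded-middle λ where
        (yes c⇝b₁) → advance j c≢x c⇝b₁ cand λ cand′ → follow c c cand′ (inj₁ refl) rest
        (no  cut)  → follow x c cand (inj₂ (c≢x , cut)) rest

      contradiction : ⊥
      contradiction = follow b₀ b₀ (b₀≢b₁ , b₀≢b₂ , r₀ , inj₁ refl) (inj₁ refl) (connected b₀ b₁)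

  median : ∀ {b₀ b₁ b₂} → b₀ ≢ b₁ → b₀ ≢ b₂ →
           Reach∖ᵛ T b₀ b₁ b₂ → Reach∖ᵛ T b₁ b₀ b₂ → Reach∖ᵛ T b₂ b₀ b₁ →
           ¬ ¬ (∃[ m ] m ≢ b₀ × m ≢ b₁ × m ≢ b₂ ×
                ¬ Reach∖ᵛ T m b₀ b₁ × ¬ Reach∖ᵛ T m b₀ b₂ × ¬ Reach∖ᵛ T m b₁ b₂)
  median b₀≢b₁ b₀≢b₂ r₀ r₁ r₂ no-median =
    Median.contradiction b₀≢b₁ b₀≢b₂ r₀ r₁ r₂
      λ m m≢b₀ m≢b₁ m≢b₂ cut₀₁ cut₀₂ cut₁₂ → no-median (m , m≢b₀ , m≢b₁ , m≢b₂ , cut₀₁ , cut₀₂ , cut₁₂)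

module _ {H : Multigraph} (D : TreeCutDecomposition H) where

  bag⁻¹ : Subset (nV (tree D)) → Subset (nV H)
  bag⁻¹ σ = tabulate (lookup σ ∘ bag D)

  ∈bag⁻¹⁅⁆⇒InBag : ∀ {b x} → x ∈ bag⁻¹ ⁅ b ⁆ → InBag D b x
  ∈bag⁻¹⁅⁆⇒InBag {b} x∈ = x∈⁅y⁆⇒x≡y b (lookup≡true⇒∈ (∈-tabulate⁻ x∈))

  InBag⇒∈bag⁻¹⁅⁆ : ∀ {b x} → InBag D b x → x ∈ bag⁻¹ ⁅ b ⁆
  InBag⇒∈bag⁻¹⁅⁆ {b} refl = ∈-tabulate⁺ ([]=⇒lookup (x∈⁅x⁆ b))

  InBag-card : ∀ b → CardIs (InBag D b) ∣ bag⁻¹ ⁅ b ⁆ ∣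
  InBag-card b = bag⁻¹ ⁅ b ⁆ , (λ x → ∈bag⁻¹⁅⁆⇒InBag , InBag⇒∈bag⁻¹⁅⁆) , refl

  ∉δ-bag⁻¹⇒same-side : ∀ σ {e u v} → Joins H e u v → e ∉ δ H (bag⁻¹ σ) →
                       lookup σ (bag D u) ≡ lookup σ (bag D v)
  ∉δ-bag⁻¹⇒same-side σ {u = u} {v} j e∉δ =
    trans (sym (lookup∘tabulate _ u)) (trans (∉δ⇒same-side (bag⁻¹ σ) j e∉δ) (lookup∘tabulate _ v))

  AdhLink⊆δ : ∀ l σ → (∀ {x y} → lookup σ x ≡ lookup σ y → Reach∖ˡ (tree D) l x y) →
              ∀ {e} → AdhLink D l e → e ∈ δ H (bag⁻¹ σ)
  AdhLink⊆δ l σ linked {e} (u , v , j , cut) with e ∈? δ H (bag⁻¹ σ)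
  ... | yes e∈δ = e∈δ
  ... | no  e∉δ = ⊥-elim (cut (linked (∉δ-bag⁻¹⇒same-side σ j e∉δ)))

  AdhNode⊆δ─incident : ∀ b σ →
    (∀ {x y} → x ≢ b → y ≢ b → lookup σ x ≡ lookup σ y → Reach∖ᵛ (tree D) b x y) →
    ∀ {e} → AdhNode D b e → e ∈ δ H (bag⁻¹ σ) ─ incident H (bag⁻¹ ⁅ b ⁆)
  AdhNode⊆δ─incident b σ linked {e} (u , v , j , u∉b , v∉b , cut) with e ∈? δ H (bag⁻¹ σ)
  ... | yes e∈δ = x∈p∧x∉q⇒x∈p─q e∈δ
                    (∉-both⇒∉incident (bag⁻¹ ⁅ b ⁆) j (u∉b ∘ ∈bag⁻¹⁅⁆⇒InBag) (v∉b ∘ ∈bag⁻¹⁅⁆⇒InBag))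
  ... | no  e∉δ = ⊥-elim (cut (linked u∉b v∉b (∉δ-bag⁻¹⇒same-side σ j e∉δ)))

-- The scramble number of K₃ ∘ B₂,₃

G : Multigraph
G = K3∘B23

pattern v0 = zero
pattern v1 = suc zero
pattern v2 = suc (suc zero)
pattern v3 = suc (suc (suc zero))
pattern v4 = suc (suc (suc (suc zero)))
pattern v5 = suc (suc (suc (suc (suc zero))))

pattern e0  = zero
pattern e1  = suc e0
pattern e2  = suc e1
pattern e3  = suc e2
pattern e4  = suc e3
pattern e5  = suc e4
pattern e6  = suc e5
pattern e7  = suc e6
pattern e8  = suc e7
pattern e9  = suc e8
pattern e10 = suc e9
pattern e11 = suc e10

branch : Fin 3 → Subset 6
branch zero             = fromList (v0 ∷ v3 ∷ [])
branch (suc zero)       = fromList (v1 ∷ v4 ∷ [])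
branch (suc (suc zero)) = fromList (v2 ∷ v5 ∷ [])

branch-of : ∀ v → ∃[ i ] v ∈ branch i
branch-of v0 = zero , lookup≡true⇒∈ refl
branch-of v1 = suc zero , lookup≡true⇒∈ refl
branch-of v2 = suc (suc zero) , lookup≡true⇒∈ refl
branch-of v3 = zero , lookup≡true⇒∈ refl
branch-of v4 = suc zero , lookup≡true⇒∈ refl
branch-of v5 = suc (suc zero) , lookup≡true⇒∈ refl

∣branch∣≤2 : ∀ i → ∣ branch i ∣ ≤ 2
∣branch∣≤2 zero             = ≤-refl
∣branch∣≤2 (suc zero)       = ≤-refl
∣branch∣≤2 (suc (suc zero)) = ≤-refl

∣δbranch∣≤2 : ∀ i → ∣ δ G (branch i) ∣ ≤ 2
∣δbranch∣≤2 zero             = ≤-refl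
∣δbranch∣≤2 (suc zero)       = ≤-refl
∣δbranch∣≤2 (suc (suc zero)) = ≤-refl

v0v1 : Subset 6
v0v1 = fromList (v0 ∷ v1 ∷ [])

δ[branch─v0v1]⊆incident : ∀ i → δ G (branch i ─ v0v1) ⊆ incident G v0v1
δ[branch─v0v1]⊆incident zero             = from-yes (δ G (branch zero ─ v0v1) ⊆? incident G v0v1)
δ[branch─v0v1]⊆incident (suc zero)       = from-yes (δ G (branch (suc zero) ─ v0v1) ⊆? incident G v0v1)
δ[branch─v0v1]⊆incident (suc (suc zero)) = from-yes (δ G (branch (suc (suc zero)) ─ v0v1) ⊆? incident G v0v1)

egg-avoiding-v0v1 : ∀ {X} → InducedConnected G X → (∀ {v} → v ∈ X → v ∉ v0v1) →
                    ∃[ i ] (∀ {x} → x ∈ X → x ∈ branch i)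
egg-avoiding-v0v1 {X} ((v , v∈X) , walks) X∩v0v1≡∅ with branch-of v
... | i , v∈branch = i , λ x∈X → p─q⊆p _ _ (lookup≡true⇒∈ (trans (sym (Reach-δ A avoids (walk x∈X))) v∈A))
  where
  A : Subset 6
  A = branch i ─ v0v1
  v∈A : lookup A v ≡ true
  v∈A = []=⇒lookup (x∈p∧x∉q⇒x∈p─q v∈branch (X∩v0v1≡∅ v∈X))
  avoids : ∀ {e} → e ∉ incident G v0v1 → e ∉ δ G A
  avoids e∉ e∈ = e∉ (δ[branch─v0v1]⊆incident i e∈)
  walk : ∀ {x} → x ∈ X → Reach G (_∉ incident G v0v1) (AllVerts G) v x
  walk x∈X = Reach-restrict (λ j x∈ y∈ → ∉-both⇒∉incident {H = G} v0v1 j (X∩v0v1≡∅ x∈) (X∩v0v1≡∅ y∈))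
                            (λ _ → refl) v∈X (walks _ _ v∈X x∈X)

small-hitting-set-or-cut : (S : Scramble G) →
  (∃[ C ] HittingSet S C × ∣ C ∣ ≤ 2) ⊎ (∃[ T ] EggCut S T × ∣ T ∣ ≤ 2)
small-hitting-set-or-cut S with hitting-or-missed S v0v1
... | inj₁ hits = inj₁ (v0v1 , hits , ≤-refl)
... | inj₂ (X , X∈S , X∩v0v1≡∅) with egg-avoiding-v0v1 (All.lookup (eggsConn S) X∈S) X∩v0v1≡∅
...   | i , X⊆branch with hitting-or-missed S (branch i)
...     | inj₁ hits = inj₁ (branch i , hits , ∣branch∣≤2 i)
...     | inj₂ (Y , Y∈S , Y∩branch≡∅) =
          inj₂ (δ G (branch i) , eggCut-δ S (branch i) X∈S Y∈S X⊆branch Y∩branch≡∅ , ∣δbranch∣≤2 i)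

order≤2 : ∀ (S : Scramble G) j → OrderIs S j → j ≤ 2
order≤2 S j (≤hitting , ≤cut , _) with small-hitting-set-or-cut S
... | inj₁ (C , hits , ∣C∣≤2) = ≤-trans (≤hitting C hits) ∣C∣≤2
... | inj₂ (T , cuts , ∣T∣≤2) = ≤-trans (≤cut T cuts) ∣T∣≤2

leaf-eggs : Scramble G
leaf-eggs = record
  { eggs     = ⁅ v3 ⁆ ∷ ⁅ v4 ⁆ ∷ []
  ; eggsConn = singleton-connected v3 ∷ singleton-connected v4 ∷ []
  }

leaf-egg-point : ∀ {X u} → X ∈S eggs leaf-eggs → u ∈ X → u ≡ v3 ⊎ u ≡ v4
leaf-egg-point (here refl)         u∈ = inj₁ (x∈⁅y⁆⇒x≡y v3 u∈)
leaf-egg-point (there (here refl)) u∈ = inj₂ (x∈⁅y⁆⇒x≡y v4 u∈)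

2≤hitting : ∀ C → HittingSet leaf-eggs C → 2 ≤ ∣ C ∣
2≤hitting C ((a , a∈C , a∈⁅v3⁆) ∷ (b , b∈C , b∈⁅v4⁆) ∷ [])
  with x∈⁅y⁆⇒x≡y v3 a∈⁅v3⁆ | x∈⁅y⁆⇒x≡y v4 b∈⁅v4⁆
... | refl | refl = x∈p∧y∈p∧x≢y⇒2≤∣p∣ a∈C b∈C λ ()

2≤cut-v3-v4 : ∀ {T} → ¬ Reach G (_∉ T) (AllVerts G) v3 v4 → 2 ≤ ∣ T ∣
2≤cut-v3-v4 = edge-disjoint-walks⇒2≤cut disjoint
  (step e3 (lookup≡true⇒∈ refl) (inj₂ refl) refl (step e0 (lookup≡true⇒∈ refl) (inj₁ refl) refl
  (step e6 (lookup≡true⇒∈ refl) (inj₁ refl) refl here)))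
  (step e4 (lookup≡true⇒∈ refl) (inj₂ refl) refl (step e2 (lookup≡true⇒∈ refl) (inj₁ refl) refl
  (step e1 (lookup≡true⇒∈ refl) (inj₂ refl) refl (step e7 (lookup≡true⇒∈ refl) (inj₁ refl) refl here))))
  where
  E₁ E₂ : Subset 12
  E₁ = fromList (e3 ∷ e0 ∷ e6 ∷ [])
  E₂ = fromList (e4 ∷ e2 ∷ e1 ∷ e7 ∷ [])
  disjoint : ∀ {e} → e ∈ E₁ → e ∉ E₂
  disjoint e∈E₁ e∈E₂ = ∉⊥ (x∈p∩q⁺ (e∈E₁ , e∈E₂))

2≤cut : ∀ T → EggCut leaf-eggs T → 2 ≤ ∣ T ∣
2≤cut T (_ , _ , u , v , X∈S , Y∈S , u∈X , v∈Y , _ , _ , ¬u⇝v)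
  with leaf-egg-point X∈S u∈X | leaf-egg-point Y∈S v∈Y
... | inj₁ refl | inj₁ refl = ⊥-elim (¬u⇝v here)
... | inj₂ refl | inj₂ refl = ⊥-elim (¬u⇝v here)
... | inj₁ refl | inj₂ refl = 2≤cut-v3-v4 ¬u⇝v
... | inj₂ refl | inj₁ refl = 2≤cut-v3-v4 (¬u⇝v ∘ Reach-reverse refl)

leaf-eggs-order : OrderIs leaf-eggs 2
leaf-eggs-order = 2≤hitting , 2≤cut , inj₁ (fromList (v3 ∷ v4 ∷ []) , hits , refl)
  where
  hits : HittingSet leaf-eggs (fromList (v3 ∷ v4 ∷ []))
  hits = (v3 , lookup≡true⇒∈ refl , x∈⁅x⁆ v3) ∷ (v4 , lookup≡true⇒∈ refl , x∈⁅x⁆ v4) ∷ []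

scramble-number : ScrambleNumberIs G 2
scramble-number = (leaf-eggs , leaf-eggs-order) , order≤2

-- A decomposition of width 3

pattern n0 = zero
pattern n1 = suc zero
pattern n2 = suc (suc zero)
pattern L0 = zero
pattern L1 = suc zero

path₃-ends : Fin 2 → Fin 3 × Fin 3
path₃-ends L0 = n0 , n1
path₃-ends L1 = n1 , n2

path₃ : Multigraph
path₃ = record { nV = 3 ; nE = 2 ; ends = path₃-ends }

path₃-isTree : IsTree path₃
path₃-isTree = (n0 , λ x y → to-n1 x ++ʳ Reach-reverse refl (to-n1 y)) , bridge
  where
  to-n1 : ∀ x → Reach path₃ (AllEdges path₃) (AllVerts path₃) x n1
  to-n1 n0 = step L0 refl (inj₁ refl) refl here
  to-n1 n1 = here
  to-n1 n2 = step L1 refl (inj₂ refl) refl here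
  bridge : ∀ l u v → Joins path₃ l u v → ¬ Reach∖ˡ path₃ l u v
  bridge L0 _ _ = sole-crossing-link-is-bridge ⁅ n0 ⁆ (x∈⁅y⁆⇒x≡y L0) (x∈⁅x⁆ L0)
  bridge L1 _ _ = sole-crossing-link-is-bridge ⁅ n2 ⁆ (x∈⁅y⁆⇒x≡y L1) (x∈⁅x⁆ L1)

branch-node : Fin 6 → Fin 3
branch-node v0 = n0
branch-node v1 = n1
branch-node v2 = n2
branch-node v3 = n0
branch-node v4 = n1
branch-node v5 = n2

decomposition : TreeCutDecomposition G
decomposition = record { tree = path₃ ; isTree = path₃-isTree ; bag = branch-node }

link-side : Fin 2 → Subset 3
link-side L0 = ⁅ n0 ⁆
link-side L1 = ⁅ n2 ⁆

link-sides-linked : ∀ l {x y} → lookup (link-side l) x ≡ lookup (link-side l) y → Reach∖ˡ path₃ l x y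
link-sides-linked l = linked-via-hubs (link-side l) (hub l) (λ {x} _ → to-hub l x) refl refl
  where
  hub : Fin 2 → Bool → Fin 3
  hub L0 true  = n0
  hub L1 true  = n2
  hub _  false = n1
  to-hub : ∀ l x → Reach∖ˡ path₃ l x (hub l (lookup (link-side l) x))
  to-hub L0 n0 = here
  to-hub L0 n1 = here
  to-hub L0 n2 = step L1 (λ ()) (inj₂ refl) refl here
  to-hub L1 n0 = step L0 (λ ()) (inj₁ refl) refl here
  to-hub L1 n1 = here
  to-hub L1 n2 = here

node-side : Fin 3 → Subset 3
node-side n1 = ⁅ n0 ⁆
node-side _  = ∅

node-sides-linked : ∀ b {x y} → x ≢ b → y ≢ b → lookup (node-side b) x ≡ lookup (node-side b) y →
                    Reach∖ᵛ path₃ b x y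
node-sides-linked b = linked-via-hubs (node-side b) (hub b) (to-hub b _)
  where
  hub : Fin 3 → Bool → Fin 3
  hub n1 true  = n0
  hub n1 false = n2
  hub _  _     = n1
  to-hub : ∀ b x → x ≢ b → Reach∖ᵛ path₃ b x (hub b (lookup (node-side b) x))
  to-hub n0 n0 x≢b = ⊥-elim (x≢b refl)
  to-hub n0 n1 _   = here
  to-hub n0 n2 _   = step L1 refl (inj₂ refl) (λ ()) here
  to-hub n1 n0 _   = here
  to-hub n1 n1 x≢b = ⊥-elim (x≢b refl)
  to-hub n1 n2 _   = here
  to-hub n2 n0 _   = step L0 refl (inj₁ refl) (λ ()) here
  to-hub n2 n1 _   = here
  to-hub n2 n2 x≢b = ⊥-elim (x≢b refl)

node-cut : Fin 3 → Subset 12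
node-cut b = δ G (bag⁻¹ decomposition (node-side b)) ─ incident G (bag⁻¹ decomposition ⁅ b ⁆)

n1-separates : ¬ Reach∖ᵛ path₃ n1 n0 n2
n1-separates (step L0 _ (inj₁ refl) n1≢n1 _) = n1≢n1 refl
n1-separates (step L0 _ (inj₂ ()) _ _)
n1-separates (step L1 _ (inj₁ ()) _ _)
n1-separates (step L1 _ (inj₂ ()) _ _)

AdhNode-n1 : CardIs (AdhNode decomposition n1) 1
AdhNode-n1 =
  node-cut n1 ,
  (λ e → adhesion e , AdhNode⊆δ─incident decomposition n1 (node-side n1) (node-sides-linked n1)) ,
  refl
  where
  adhesion : ∀ e → e ∈ node-cut n1 → AdhNode decomposition n1 e
  adhesion e e∈ with x∈⁅y⁆⇒x≡y e2 e∈
  ... | refl = v0 , v2 , inj₁ refl , (λ ()) , (λ ()) , n1-separates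

decomposition-width : WidthIs decomposition 3
decomposition-width =
  link-bound , node-bound , inj₂ (n1 , 2 , 1 , InBag-card decomposition n1 , AdhNode-n1 , refl)
  where
  ∣link-cut∣≤3 : ∀ l → ∣ δ G (bag⁻¹ decomposition (link-side l)) ∣ ≤ 3
  ∣link-cut∣≤3 L0 = s≤s (s≤s z≤n)
  ∣link-cut∣≤3 L1 = s≤s (s≤s z≤n)
  ∣node∣≤3 : ∀ b → ∣ bag⁻¹ decomposition ⁅ b ⁆ ∣ + ∣ node-cut b ∣ ≤ 3
  ∣node∣≤3 n0 = s≤s (s≤s z≤n)
  ∣node∣≤3 n1 = ≤-refl
  ∣node∣≤3 n2 = s≤s (s≤s z≤n)
  link-bound : ∀ l s → CardIs (AdhLink decomposition l) s → s ≤ 3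
  link-bound l s card =
    ≤-trans (CardIs-⊆ card (AdhLink⊆δ decomposition l (link-side l) (link-sides-linked l))) (∣link-cut∣≤3 l)
  node-bound : ∀ b s t → CardIs (InBag decomposition b) s → CardIs (AdhNode decomposition b) t → s + t ≤ 3
  node-bound b s t bag-card adh-card =
    ≤-trans (+-mono-≤ (CardIs-⊆ bag-card (InBag⇒∈bag⁻¹⁅⁆ decomposition))
                      (CardIs-⊆ adh-card (AdhNode⊆δ─incident decomposition b (node-side b) (node-sides-linked b))))
            (∣node∣≤3 b)

-- No decomposition of width 2

module _ (D : TreeCutDecomposition G) {w} (W : WidthIs D w) (w≤2 : w ≤ 2) where

  private
    b : Fin 6 → Fin (nV (tree D))
    b = bag D

    ¬3≤w : ¬ 3 ≤ w
    ¬3≤w 3≤w with ≤-trans 3≤w w≤2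
    ... | s≤s (s≤s ())

  no-wide-link : ∀ l es → All (AdhLink D l) es → 3 ≤ ∣ fromList es ∣ → ⊥
  no-wide-link l es adhesion 3≤ = ¬¬-CardIs (AdhLink D l) λ (s , card) →
    ¬3≤w (≤-trans 3≤ (≤-trans (CardIs-⊇ card (fromList⊆ adhesion)) (proj₁ W l s card)))

  no-wide-node : ∀ c vs es → All (InBag D c) vs → All (AdhNode D c) es →
                 3 ≤ ∣ fromList vs ∣ + ∣ fromList es ∣ → ⊥
  no-wide-node c vs es inBag adhesion 3≤ =
    ¬¬-CardIs (InBag D c) λ (s , bag-card) → ¬¬-CardIs (AdhNode D c) λ (t , adh-card) →
    ¬3≤w (≤-trans 3≤ (≤-trans (+-mono-≤ (CardIs-⊇ bag-card (fromList⊆ inBag))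
                                        (CardIs-⊇ adh-card (fromList⊆ adhesion)))
                              (proj₁ (proj₂ W) c s t bag-card adh-card)))

  parallel-edges-share-bag : ∀ {u v ea eb ec} → Joins G ea u v → Joins G eb u v → Joins G ec u v →
                             3 ≤ ∣ fromList (ea ∷ eb ∷ ec ∷ []) ∣ → b v ≡ b u
  parallel-edges-share-bag {u} {v} {ea} {eb} {ec} ja jb jc 3≤ with b u ≟ b v
  ... | yes bu≡bv = sym bu≡bv
  ... | no  bu≢bv with separating-link (isTree D) bu≢bv
  ...   | l , cut =
    ⊥-elim (no-wide-link l (ea ∷ eb ∷ ec ∷ []) ((u , v , ja , cut) ∷ (u , v , jb , cut) ∷ (u , v , jc , cut) ∷ []) 3≤)

  branch-bag-does-not-separate : ∀ {x x' y z e} → b x' ≡ b x → Joins G e y z → b y ≢ b x → b z ≢ b x →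
                                 3 ≤ ∣ fromList (x ∷ x' ∷ []) ∣ + ∣ fromList (e ∷ []) ∣ →
                                 ¬ ¬ Reach∖ᵛ (tree D) (b x) (b y) (b z)
  branch-bag-does-not-separate {x} {x'} {y} {z} {e} x'∈ j y∉ z∉ 3≤ cut =
    no-wide-node (b x) (x ∷ x' ∷ []) (e ∷ []) (refl ∷ x'∈ ∷ []) ((y , z , j , y∉ , z∉ , cut) ∷ []) 3≤

  distinct-branch-bags : b v3 ≡ b v0 → b v4 ≡ b v1 → b v5 ≡ b v2 →
                         b v0 ≢ b v1 → b v0 ≢ b v2 → b v1 ≢ b v2 → ⊥
  distinct-branch-bags b₃ b₄ b₅ b₀≢b₁ b₀≢b₂ b₁≢b₂ =
    branch-bag-does-not-separate {v0} {v3} {e = e1} b₃ (inj₁ refl) (b₀≢b₁ ∘ sym) (b₀≢b₂ ∘ sym) ≤-refl λ r₀ →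
    branch-bag-does-not-separate {v1} {v4} {e = e2} b₄ (inj₁ refl) b₀≢b₁ (b₁≢b₂ ∘ sym) ≤-refl λ r₁ →
    branch-bag-does-not-separate {v2} {v5} {e = e0} b₅ (inj₁ refl) b₀≢b₂ b₁≢b₂ ≤-refl λ r₂ →
    median (isTree D) b₀≢b₁ b₀≢b₂ r₀ r₁ r₂ λ (m , m≢b₀ , m≢b₁ , m≢b₂ , cut₀₁ , cut₀₂ , cut₁₂) →
    no-wide-node m [] (e0 ∷ e1 ∷ e2 ∷ []) []
      ( (v0 , v1 , inj₁ refl , m≢b₀ ∘ sym , m≢b₁ ∘ sym , cut₀₁)
      ∷ (v1 , v2 , inj₁ refl , m≢b₁ ∘ sym , m≢b₂ ∘ sym , cut₁₂)
      ∷ (v0 , v2 , inj₁ refl , m≢b₀ ∘ sym , m≢b₂ ∘ sym , cut₀₂) ∷ [])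
      ≤-refl

  private
    3≤4 : 3 ≤ 4 + 0
    3≤4 = s≤s (s≤s (s≤s z≤n))

    b₃ : b v3 ≡ b v0
    b₃ = parallel-edges-share-bag {ea = e3} {e4} {e5} (inj₁ refl) (inj₁ refl) (inj₁ refl) ≤-refl

    b₄ : b v4 ≡ b v1
    b₄ = parallel-edges-share-bag {ea = e6} {e7} {e8} (inj₁ refl) (inj₁ refl) (inj₁ refl) ≤-refl

    b₅ : b v5 ≡ b v2
    b₅ = parallel-edges-share-bag {ea = e9} {e10} {e11} (inj₁ refl) (inj₁ refl) (inj₁ refl) ≤-refl

  width≤2-impossible : ⊥
  width≤2-impossible with b v0 ≟ b v1 | b v0 ≟ b v2 | b v1 ≟ b v2
  ... | yes b₀≡b₁ | _         | _         =
    no-wide-node (b v0) (v0 ∷ v3 ∷ v1 ∷ v4 ∷ []) [] (refl ∷ b₃ ∷ sym b₀≡b₁ ∷ trans b₄ (sym b₀≡b₁) ∷ []) [] 3≤4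
  ... | no _      | yes b₀≡b₂ | _         =
    no-wide-node (b v0) (v0 ∷ v3 ∷ v2 ∷ v5 ∷ []) [] (refl ∷ b₃ ∷ sym b₀≡b₂ ∷ trans b₅ (sym b₀≡b₂) ∷ []) [] 3≤4
  ... | no _      | no _      | yes b₁≡b₂ =
    no-wide-node (b v1) (v1 ∷ v4 ∷ v2 ∷ v5 ∷ []) [] (refl ∷ b₄ ∷ sym b₁≡b₂ ∷ trans b₅ (sym b₁≡b₂) ∷ []) [] 3≤4
  ... | no b₀≢b₁  | no b₀≢b₂  | no b₁≢b₂  = distinct-branch-bags b₃ b₄ b₅ b₀≢b₁ b₀≢b₂ b₁≢b₂

width≥3 : ∀ (D : TreeCutDecomposition G) w → WidthIs D w → 3 ≤ w
width≥3 D w W with 3 ≤? w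
... | yes 3≤w = 3≤w
... | no  3≰w = ⊥-elim (width≤2-impossible D W (≤-pred (≰⇒> 3≰w)))

mainTheorem10 : ScrambleNumberIs K3∘B23 2 × ScreewidthIs K3∘B23 3
mainTheorem10 = scramble-number , (decomposition , decomposition-width) , width≥3
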